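{- Let $E$ be a finite nonempty set, let $u_1:2^E\to\mathbb{R}$ be an ordinally w-concave function satisfying the unique-maximizer condition (for every $X\subseteq E$ the problem $\max\{u_1(Y)\mid Y\subseteq X\}$ has a unique maximizer), and let $u_2:2^E\to\mathbb{R}$ be ordinally w-concave. Then the lexicographic composition $\hat u=u_1\diamond u_2$ is ordinally w-concave, i.e., for every $X,Y\in 2^E$ with $X\neq Y$ there exist distinct $x\in(X\setminus Y)\cup\{\emptyset\}$ and $y\in(Y\setminus X)\cup\{\emptyset\}$ such that $\hat u(X)<_\ell\hat u(X-x+y)$, or $\hat u(Y)<_\ell\hat u(Y-y+x)$, or ($\hat u(X)=\hat u(X-x+y)$ and $\hat u(Y)=\hat u(Y-y+x)$).
   Context: Notation: for $X\subseteq E$ and $x\in E\setminus X$, $X+x=X\cup\{x\}$; for $x\in X$, $X-x=X\setminus\{x\}$. The symbol $\emptyset$ is also used as a formal element not in $E$, with $X+\emptyset=X-\emptyset=X$. A function $u:2^E\to\mathbb{R}$ is ordinally w-concave if for every $X,X'\in 2^E$ with $X\neq X'$ there exist distinct $x\in(X\setminus X')\cup\{\emptyset\}$ and $x'\in(X'\setminus X)\cup\{\emptyset\}$ such that (i) $u(X)<u(X-x+x')$, or (ii) $u(X')<u(X'-x'+x)$, or (iii) $u(X)=u(X-x+x')$ and $u(X')=u(X'-x'+x)$. The lexicographic order on $\mathbb{R}^2$: $(a,b)<_\ell(c,d)$ iff $a<c$, or $a=c$ and $b<d$. The lexicographic composition $\hat u=u_1\diamond u_2:2^E\to\mathbb{R}^2$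 is defined by letting $\hat u(X)$ be the lexicographic maximum of $(u_1(X_1),u_2(X\setminus X_1))$ over all $X_1\subseteq X$ (with respect to $\le_\ell$). -}

module Defs where

open import Level using (0ℓ)
open import Data.Nat using (ℕ; suc)
open import Data.Fin using (Fin)
open import Data.Fin.Subset using (Subset; _∈_; _∉_; _⊆_; inside; outside)
open import Data.Vec using (_[_]≔_)
open import Data.Maybe using (Maybe; just; nothing)
open import Data.Product using (_×_; ∃; _,_)
open import Data.Sum using (_⊎_)
open import Data.Unit using (⊤)
open import Relation.Binary.PropositionalEquality using (_≡_)
open import Relation.Nullary using (¬_)
open import Relation.Binary using (Rel)

-- The ground set E is Fin n (nonempty: n = suc m).  A subset of E is a
-- 'Subset n'.  An element of (X \ Y) ∪ {∅} is 'x : Maybe (Fin n)',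
-- with 'nothing' playing the role of the formal element ∅.

InDiff : ∀ {n} → Subset n → Subset n → Maybe (Fin n) → Set
InDiff X Y nothing  = ⊤
InDiff X Y (just a) = (a ∈ X) × (a ∉ Y)

remove : ∀ {n} → Subset n → Maybe (Fin n) → Subset n
remove X nothing  = X
remove X (just a) = X [ a ]≔ outside

add : ∀ {n} → Subset n → Maybe (Fin n) → Subset n
add X nothing  = X
add X (just a) = X [ a ]≔ inside

exch : ∀ {n} → Subset n → Maybe (Fin n) → Maybe (Fin n) → Subset n
exch X x y = add (remove X x) y

OrdWConcave : ∀ {n} {B : Set} → Rel B 0ℓ → Rel B 0ℓ → (Subset n → B) → Set
OrdWConcave {n} _<_ _≈_ u =
  ∀ (X Y : Subset n) → ¬ (X ≡ Y) →
  ∃ λ (x : Maybe (Fin n)) → ∃ λ (y : Maybe (Fin n)) →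
    InDiff X Y x × InDiff Y X y × ¬ (x ≡ y) ×
    ( (u X < u (exch X x y))
    ⊎ (u Y < u (exch Y y x))
    ⊎ ((u X ≈ u (exch X x y)) × (u Y ≈ u (exch Y y x))) )

IsMaximizer : ∀ {n} {A : Set} → Rel A 0ℓ → (Subset n → A) → Subset n → Subset n → Set
IsMaximizer _<_ u X Z = (Z ⊆ X) × (∀ W → W ⊆ X → ¬ (u Z < u W))

UniqueMaximizer : ∀ {n} {A : Set} → Rel A 0ℓ → (Subset n → A) → Set
UniqueMaximizer {n} _<_ u =
  ∀ (X : Subset n) → ∃ λ Z → IsMaximizer _<_ u X Z × (∀ Z' → IsMaximizer _<_ u X Z' → Z' ≡ Z)

module Lex {A : Set} (_<_ : Rel A 0ℓ) (_≈_ : Rel A 0ℓ) where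
  _<ℓ_ : Rel (A × A) 0ℓ
  (a , b) <ℓ (c , d) = (a < c) ⊎ ((a ≈ c) × (b < d))

  _≈ℓ_ : Rel (A × A) 0ℓ
  (a , b) ≈ℓ (c , d) = (a ≈ c) × (b ≈ d)

  open import Data.Fin.Subset using (_─_)

  IsLexComposition : ∀ {n} → (Subset n → A) → (Subset n → A) → (Subset n → A × A) → Set
  IsLexComposition u₁ u₂ û =
    ∀ X → (∃ λ X₁ → (X₁ ⊆ X) × (û X ≈ℓ (u₁ X₁ , u₂ (X ─ X₁))))
        × (∀ X₁ → X₁ ⊆ X → ¬ (û X <ℓ (u₁ X₁ , u₂ (X ─ X₁))))

-- Let L X be the first part of an optimal split of X, so that û X ≈ (u₁ (L X) , u₂ (X ─ L X)).
-- By the unique-maximizer condition every other subset of X has strictly smaller u₁-value, so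
-- whenever Z ⊆ X′ ties with L X in u₁, either û strictly gains from X to X′, or Z = L X′ and
-- the comparison is decided by u₂ alone.
-- If L X = L Y = Z, an exchange for u₂ between X ─ Z and Y ─ Z avoids Z and transfers to X and
-- Y in this way. If L X ≠ L Y, take an exchange (x , y) for u₁ between L X and L Y. When x ∉ Y
-- and y ∉ X it is also an exchange between X and Y, and it leaves X ─ L X and Y ─ L Y unchanged.
-- Otherwise, say x ∈ Y: then L Y - y + x ⊆ Y, so maximality and uniqueness of L Y leave only a
-- strict u₁-gain from L X to L X - x + y; maximality of L X forces y ∉ X, and since
-- L X - x + y ⊆ X + y, the exchange (∅ , y) is a strict gain for û.
module Submission where

open import Defs
open import Level using (0ℓ)
open import Function using (_∘_)
open import Data.Bool using (Bool)
import Data.Bool as Bool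
open import Data.Nat using (ℕ; suc)
open import Data.Fin using (Fin; zero; _≟_)
open import Data.Fin.Subset using (Subset; _∈_; _∉_; _⊆_; inside; outside; _─_)
open import Data.Fin.Subset.Properties
  using (_∈?_; ⊆-antisym; p─q⊆p; x∈p∧x∉q⇒x∈p─q; drop-there)
open import Data.Vec using (_∷_; _[_]≔_; here; there)
open import Data.Vec.Properties
  using ([]≔-updates; []≔-minimal; lookup∘update; lookup∘update′; []=⇒lookup; lookup⇒[]=; ≡-dec)
open import Data.Maybe using (Maybe; just; nothing)
open import Data.Maybe.Relation.Unary.All using (All; just; nothing)
import Data.Maybe.Relation.Unary.All as All
open import Data.Product using (_×_; _,_; proj₁; proj₂; ∃-syntax)
import Data.Product as Product
open import Data.Product.Relation.Binary.Lex.Strict using (×-strictTotalOrder)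
open import Data.Sum using (_⊎_; inj₁; inj₂)
import Data.Sum as Sum
open import Data.Unit using (tt)
open import Relation.Nullary using (¬_; yes; no; contradiction)
open import Relation.Binary using (Rel; tri<; tri≈; tri>)
open import Relation.Binary.Bundles using (StrictTotalOrder)
open import Relation.Binary.PropositionalEquality
  using (_≡_; _≢_; refl; sym; trans; cong; subst)

private variable
  n : ℕ
  i a : Fin n
  v : Bool
  X Y Z Z₀ A B : Subset n
  x y : Maybe (Fin n)

All-at : ∀ {P : Fin n → Set} → All P x → x ≡ just i → P i
All-at (just p) refl = p

∈-[]≔⁻ : i ≢ a → i ∈ X [ a ]≔ v → i ∈ X
∈-[]≔⁻ {i = i} {X = X} i≢a i∈ =
  lookup⇒[]= i X (trans (sym (lookup∘update′ i≢a X _)) ([]=⇒lookup i∈))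

∉-[]≔-outside : a ∉ X [ a ]≔ outside
∉-[]≔-outside {a = a} {X = X} a∈
  with () ← trans (sym (lookup∘update a X outside)) ([]=⇒lookup a∈)

∈-remove⁺ : i ∈ X → x ≢ just i → i ∈ remove X x
∈-remove⁺ {x = nothing} i∈X _ = i∈X
∈-remove⁺ {i = i} {X = X} {x = just a} i∈X a≢i = []≔-minimal X i a (a≢i ∘ cong just ∘ sym) i∈X

∈-remove⁻ : i ∈ remove X x → i ∈ X × x ≢ just i
∈-remove⁻ {x = nothing} i∈ = i∈ , λ ()
∈-remove⁻ {i = i} {x = just a} i∈ with i ≟ a
... | yes refl = contradiction i∈ ∉-[]≔-outside
... | no i≢a = ∈-[]≔⁻ i≢a i∈ , λ { refl → i≢a refl }

∈-add⁺ : i ∈ X → i ∈ add X y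
∈-add⁺ {y = nothing} i∈X = i∈X
∈-add⁺ {i = i} {y = just a} i∈X with i ≟ a
... | yes refl = []≔-updates _ a
... | no i≢a = []≔-minimal _ i a i≢a i∈X

∈-add-new : y ≡ just i → i ∈ add X y
∈-add-new refl = []≔-updates _ _

∈-add⁻ : i ∈ add X y → i ∈ X ⊎ y ≡ just i
∈-add⁻ {y = nothing} i∈ = inj₁ i∈
∈-add⁻ {i = i} {y = just a} i∈ with i ≟ a
... | yes refl = inj₂ refl
... | no i≢a = inj₁ (∈-[]≔⁻ i≢a i∈)

∈-exch⁺ : ∀ x y → i ∈ X → x ≢ just i → i ∈ exch X x y
∈-exch⁺ x y i∈X x≢i = ∈-add⁺ {y = y} (∈-remove⁺ i∈X x≢i)

∈-exch-new : ∀ X x → y ≡ just i → i ∈ exch X x y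
∈-exch-new X x = ∈-add-new

∈-exch⁻ : ∀ X x y → i ∈ exch X x y → (i ∈ X × x ≢ just i) ⊎ y ≡ just i
∈-exch⁻ X x y = Sum.map₁ ∈-remove⁻ ∘ ∈-add⁻

∈-─⁻ : ∀ (X Z : Subset n) → i ∈ X ─ Z → i ∈ X × i ∉ Z
∈-─⁻ (inside ∷ X) (outside ∷ Z) here = here , λ ()
∈-─⁻ {i = zero} (outside ∷ X) (outside ∷ Z) ()
∈-─⁻ {i = zero} (outside ∷ X) (inside ∷ Z) ()
∈-─⁻ {i = zero} (inside ∷ X) (inside ∷ Z) ()
∈-─⁻ (_ ∷ X) (_ ∷ Z) (there i∈) =
  Product.map there (λ i∉Z → i∉Z ∘ drop-there) (∈-─⁻ X Z i∈)

exch-mono : ∀ x y → A ⊆ B → exch A x y ⊆ exch B x y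
exch-mono {A = A} {B = B} x y A⊆B i∈ with ∈-exch⁻ A x y i∈
... | inj₁ (i∈A , x≢i) = ∈-exch⁺ x y (A⊆B i∈A) x≢i
... | inj₂ y≡i = ∈-exch-new B x y≡i

exch-⊆ : ∀ x y → A ⊆ B → All (_∈ B) y → exch A x y ⊆ B
exch-⊆ {A = A} x y A⊆B y∈B i∈ with ∈-exch⁻ A x y i∈
... | inj₁ (i∈A , _) = A⊆B i∈A
... | inj₂ y≡i = All-at y∈B y≡i

⊆-exch : ∀ x y → Z ⊆ X → All (_∉ Z) x → Z ⊆ exch X x y
⊆-exch x y Z⊆X x∉Z i∈Z = ∈-exch⁺ x y (Z⊆X i∈Z) (λ x≡i → All-at x∉Z x≡i i∈Z)

exch-─-exch : ∀ x y → A ⊆ B → All (_∈ A) x → All (_∉ B) y →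
              exch B x y ─ exch A x y ≡ B ─ A
exch-─-exch {A = A} {B = B} x y A⊆B x∈A y∉B = ⊆-antisym to from
  where
  to : exch B x y ─ exch A x y ⊆ B ─ A
  to i∈ with ∈-─⁻ (exch B x y) (exch A x y) i∈
  ... | i∈B′ , i∉A′ with ∈-exch⁻ B x y i∈B′
  ...   | inj₁ (i∈B , x≢i) = x∈p∧x∉q⇒x∈p─q i∈B (λ i∈A → i∉A′ (∈-exch⁺ x y i∈A x≢i))
  ...   | inj₂ y≡i = contradiction (∈-exch-new A x y≡i) i∉A′
  from : B ─ A ⊆ exch B x y ─ exch A x y
  from {i} i∈ with ∈-─⁻ B A i∈
  ... | i∈B , i∉A = x∈p∧x∉q⇒x∈p─q (∈-exch⁺ x y i∈B (λ x≡i → i∉A (All-at x∈A x≡i))) i∉A′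
    where
    i∉A′ : i ∉ exch A x y
    i∉A′ i∈A′ with ∈-exch⁻ A x y i∈A′
    ... | inj₁ (i∈A , _) = i∉A i∈A
    ... | inj₂ y≡i = All-at y∉B y≡i i∈B

exch-─ : ∀ x y → All (_∉ Z) x → All (_∉ Z) y → exch X x y ─ Z ≡ exch (X ─ Z) x y
exch-─ {Z = Z} {X = X} x y x∉Z y∉Z = ⊆-antisym to from
  where
  to : exch X x y ─ Z ⊆ exch (X ─ Z) x y
  to i∈ with ∈-─⁻ (exch X x y) Z i∈
  ... | i∈X′ , i∉Z with ∈-exch⁻ X x y i∈X′
  ...   | inj₁ (i∈X , x≢i) = ∈-exch⁺ x y (x∈p∧x∉q⇒x∈p─q i∈X i∉Z) x≢i
  ...   | inj₂ y≡i = ∈-exch-new (X ─ Z) x y≡i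
  from : exch (X ─ Z) x y ⊆ exch X x y ─ Z
  from i∈ with ∈-exch⁻ (X ─ Z) x y i∈
  ... | inj₁ (i∈X─Z , x≢i) =
    x∈p∧x∉q⇒x∈p─q (∈-exch⁺ x y (p─q⊆p X Z i∈X─Z) x≢i) (proj₂ (∈-─⁻ X Z i∈X─Z))
  ... | inj₂ y≡i = x∈p∧x∉q⇒x∈p─q (∈-exch-new X x y≡i) (All-at y∉Z y≡i)

─-cancelʳ : Z ⊆ X → Z ⊆ Y → X ─ Z ≡ Y ─ Z → X ≡ Y
─-cancelʳ Z⊆X Z⊆Y eq = ⊆-antisym (⊆-from Z⊆Y eq) (⊆-from Z⊆X (sym eq))
  where
  ⊆-from : ∀ {X Y Z : Subset n} → Z ⊆ Y → X ─ Z ≡ Y ─ Z → X ⊆ Y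
  ⊆-from {X = X} {Y} {Z} Z⊆Y eq {i} i∈X with i ∈? Z
  ... | yes i∈Z = Z⊆Y i∈Z
  ... | no i∉Z = p─q⊆p Y Z (subst (i ∈_) eq (x∈p∧x∉q⇒x∈p─q i∈X i∉Z))

InDiff-─ : ∀ x → InDiff (X ─ Z) (Y ─ Z) x → InDiff X Y x × All (_∉ Z) x
InDiff-─ nothing _ = tt , nothing
InDiff-─ {X = X} {Z = Z} (just a) (a∈X─Z , a∉Y─Z) with ∈-─⁻ X Z a∈X─Z
... | a∈X , a∉Z = (a∈X , λ a∈Y → a∉Y─Z (x∈p∧x∉q⇒x∈p─q a∈Y a∉Z)) , just a∉Z

InDiff⇒All : ∀ x → InDiff X Y x → All (_∈ X) x
InDiff⇒All nothing _ = nothing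
InDiff⇒All (just a) (a∈X , _) = just a∈X

InDiff⁺ : ∀ x → All (_∈ X) x → All (_∉ Y) x → InDiff X Y x
InDiff⁺ nothing _ _ = tt
InDiff⁺ (just a) (just a∈X) (just a∉Y) = a∈X , a∉Y

avoids-or-hits : ∀ (A : Subset n) x → All (_∉ A) x ⊎ ∃[ a ] (x ≡ just a × a ∈ A)
avoids-or-hits A nothing = inj₁ nothing
avoids-or-hits A (just a) with a ∈? A
... | yes a∈A = inj₂ (a , refl , a∈A)
... | no a∉A = inj₁ (just a∉A)

module _ {A : Set} (_<_ _≈_ : Rel A 0ℓ) where

  GainOrTie : A → A → A → A → Set
  GainOrTie a a′ b b′ = a < a′ ⊎ b < b′ ⊎ (a ≈ a′ × b ≈ b′)

  GainOrTie-swap : ∀ {a a′ b b′} → GainOrTie a a′ b b′ → GainOrTie b b′ a a′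
  GainOrTie-swap (inj₁ gain) = inj₂ (inj₁ gain)
  GainOrTie-swap (inj₂ (inj₁ gain)) = inj₁ gain
  GainOrTie-swap (inj₂ (inj₂ (tie , tie′))) = inj₂ (inj₂ (tie′ , tie))

  ExchangePair : (Subset n → A) → Subset n → Subset n → Set
  ExchangePair {n} u X Y = ∃[ x ] ∃[ y ] InDiff X Y x × InDiff Y X y × x ≢ y ×
    GainOrTie (u X) (u (exch X x y)) (u Y) (u (exch Y y x))

  ExchangePair-swap : ∀ {u : Subset n → A} → ExchangePair u X Y → ExchangePair u Y X
  ExchangePair-swap (x , y , x∈X∖Y , y∈Y∖X , x≢y , gainOrTie) =
    y , x , y∈Y∖X , x∈X∖Y , x≢y ∘ sym , GainOrTie-swap gainOrTie

module Transfer {A B : Set} (_<₁_ _≈₁_ : Rel A 0ℓ) (_<₂_ _≈₂_ : Rel B 0ℓ) where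

  _⇝_ : A × A → B × B → Set
  (a , a′) ⇝ (p , p′) = (a <₁ a′ → p <₂ p′) × (a ≈₁ a′ → p <₂ p′ ⊎ p ≈₂ p′)

  GainOrTie-transfer : ∀ {a a′ b b′ p p′ q q′} → (a , a′) ⇝ (p , p′) → (b , b′) ⇝ (q , q′) →
    GainOrTie _<₁_ _≈₁_ a a′ b b′ → GainOrTie _<₂_ _≈₂_ p p′ q q′
  GainOrTie-transfer (gainˡ , _) _ (inj₁ gain) = inj₁ (gainˡ gain)
  GainOrTie-transfer _ (gainʳ , _) (inj₂ (inj₁ gain)) = inj₂ (inj₁ (gainʳ gain))
  GainOrTie-transfer (_ , tieˡ) (_ , tieʳ) (inj₂ (inj₂ (tie , tie′))) with tieˡ tie | tieʳ tie′
  ... | inj₁ gain | _ = inj₁ gain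
  ... | inj₂ _ | inj₁ gain = inj₂ (inj₁ gain)
  ... | inj₂ eq | inj₂ eq′ = inj₂ (inj₂ (eq , eq′))

module LexComposition (O : StrictTotalOrder 0ℓ 0ℓ 0ℓ) {n : ℕ}
  (u₁ u₂ : Subset n → StrictTotalOrder.Carrier O)
  (û : Subset n → StrictTotalOrder.Carrier O × StrictTotalOrder.Carrier O)
  (lex : Lex.IsLexComposition (StrictTotalOrder._<_ O) (StrictTotalOrder._≈_ O) u₁ u₂ û)
  where

  open StrictTotalOrder O renaming (Carrier to C; trans to <-trans)
  -- These are definitionally the orders Lex._<ℓ_ and Lex._≈ℓ_ of the statement.
  open StrictTotalOrder (×-strictTotalOrder O O) using ()
    renaming ( _<_ to _<ℓ_; _≈_ to _≈ℓ_; module Eq to Eqℓ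
             ; <-respˡ-≈ to <ℓ-respˡ-≈; <-respʳ-≈ to <ℓ-respʳ-≈)
  open Transfer _<_ _≈_ _<ℓ_ _≈ℓ_

  private variable
    W X′ : Subset n

  L : Subset n → Subset n
  L X = proj₁ (proj₁ (lex X))

  L⊆ : L X ⊆ X
  L⊆ {X} = proj₁ (proj₂ (proj₁ (lex X)))

  split : Subset n → C × C
  split X = u₁ (L X) , u₂ (X ─ L X)

  û≈split : ∀ X → û X ≈ℓ split X
  û≈split X = proj₂ (proj₂ (proj₁ (lex X)))

  û-< : split X <ℓ split X′ → û X <ℓ û X′
  û-< {X} {X′} lt = <ℓ-respʳ-≈ (Eqℓ.sym (û≈split X′)) (<ℓ-respˡ-≈ (Eqℓ.sym (û≈split X)) lt)

  û-≈ : split X ≈ℓ split X′ → û X ≈ℓ û X′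
  û-≈ {X} {X′} eq = Eqℓ.trans (û≈split X) (Eqℓ.trans eq (Eqℓ.sym (û≈split X′)))

  L-maximal : W ⊆ X → ¬ u₁ (L X) < u₁ W
  L-maximal {W} {X} W⊆X gain =
    proj₂ (lex X) W W⊆X (<ℓ-respˡ-≈ (Eqℓ.sym (û≈split X)) (inj₁ gain))

  L≡⇒⊆ : L X ≡ Z → Z ⊆ X
  L≡⇒⊆ refl = L⊆

  L-isMaximizer : IsMaximizer _<_ u₁ X (L X)
  L-isMaximizer = L⊆ , λ W → L-maximal

  module _ (unique : UniqueMaximizer _<_ u₁) where

    L-unique : IsMaximizer _<_ u₁ X Z → Z ≡ L X
    L-unique {X} Z-max with unique X
    ... | _ , _ , unique-X = trans (unique-X _ Z-max) (sym (unique-X _ L-isMaximizer))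

    L-dominates : Z ⊆ X → u₁ Z < u₁ (L X) ⊎ Z ≡ L X
    L-dominates {Z} {X} Z⊆X with compare (u₁ Z) (u₁ (L X))
    ... | tri< worse _ _ = inj₁ worse
    ... | tri≈ _ tie _ = inj₂ (L-unique (Z⊆X , λ W W⊆X gain → L-maximal W⊆X (<-respˡ-≈ tie gain)))
    ... | tri> _ _ gain = contradiction gain (L-maximal Z⊆X)

    first-gain : Z ⊆ X′ → u₁ (L X) < u₁ Z → û X <ℓ û X′
    first-gain Z⊆X′ gain with L-dominates Z⊆X′
    ... | inj₁ worse = û-< (inj₁ (<-trans gain worse))
    ... | inj₂ refl = û-< (inj₁ gain)

    first-tie : Z ⊆ X′ → u₁ (L X) ≈ u₁ Z → û X <ℓ û X′ ⊎ Z ≡ L X′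
    first-tie Z⊆X′ tie with L-dominates Z⊆X′
    ... | inj₁ worse = inj₁ (û-< (inj₁ (<-respˡ-≈ (Eq.sym tie) worse)))
    ... | inj₂ Z≡L = inj₂ Z≡L

    second-transfer : L X ≡ Z₀ → Z ⊆ X′ → u₁ Z₀ ≈ u₁ Z →
      (u₂ (X ─ Z₀) , u₂ (X′ ─ Z)) ⇝ (û X , û X′)
    second-transfer refl Z⊆X′ tie with first-tie Z⊆X′ tie
    ... | inj₁ gain = (λ _ → gain) , (λ _ → inj₁ gain)
    ... | inj₂ refl = (λ lt → û-< (inj₂ (tie , lt))) , (λ eq → inj₂ (û-≈ (tie , eq)))

    first-transfer : Z ⊆ X′ → X′ ─ Z ≡ X ─ L X → (u₁ (L X) , u₁ Z) ⇝ (û X , û X′)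
    first-transfer Z⊆X′ same-rest =
      first-gain Z⊆X′ ,
      λ tie → proj₂ (second-transfer refl Z⊆X′ tie) (Eq.reflexive (cong u₂ (sym same-rest)))

    exchange-L≡ : OrdWConcave _<_ _≈_ u₂ → L X ≡ Z → L Y ≡ Z → X ≢ Y →
      ExchangePair _<ℓ_ _≈ℓ_ û X Y
    exchange-L≡ {X} {Z} {Y} w₂ LX≡Z LY≡Z X≢Y
      with w₂ (X ─ Z) (Y ─ Z) (X≢Y ∘ ─-cancelʳ (L≡⇒⊆ LX≡Z) (L≡⇒⊆ LY≡Z))
    ... | x , y , x∈X─Z∖Y─Z , y∈Y─Z∖X─Z , x≢y , gainOrTie
      with InDiff-─ {X = X} {Z = Z} {Y = Y} x x∈X─Z∖Y─Z
         | InDiff-─ {X = Y} {Z = Z} {Y = X} y y∈Y─Z∖X─Z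
    ... | x∈X∖Y , x∉Z | y∈Y∖X , y∉Z =
      x , y , x∈X∖Y , y∈Y∖X , x≢y ,
      GainOrTie-transfer (transfer LX≡Z x y x∉Z y∉Z) (transfer LY≡Z y x y∉Z x∉Z) gainOrTie
      where
      transfer : L W ≡ Z → ∀ x y → All (_∉ Z) x → All (_∉ Z) y →
        (u₂ (W ─ Z) , u₂ (exch (W ─ Z) x y)) ⇝ (û W , û (exch W x y))
      transfer {W} LW≡Z x y x∉Z y∉Z =
        subst (λ V → (u₂ (W ─ Z) , u₂ V) ⇝ (û W , û (exch W x y))) (exch-─ x y x∉Z y∉Z)
          (second-transfer LW≡Z (⊆-exch x y (L≡⇒⊆ LW≡Z) x∉Z) Eq.refl)

    exchange-hitting : a ∈ Y → InDiff (L X) (L Y) (just a) → InDiff (L Y) (L X) y →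
      GainOrTie _<_ _≈_ (u₁ (L X)) (u₁ (exch (L X) (just a) y))
                        (u₁ (L Y)) (u₁ (exch (L Y) y (just a))) →
      ExchangePair _<ℓ_ _≈ℓ_ û X Y
    exchange-hitting {a = a} {y = nothing} _ _ _ (inj₁ gain) =
      contradiction gain (L-maximal (exch-⊆ (just a) nothing L⊆ nothing))
    exchange-hitting {a = a} {X = X} {y = just b} _ _ (b∈LY , _) (inj₁ gain) with b ∈? X
    ... | yes b∈X = contradiction gain (L-maximal (exch-⊆ (just a) (just b) L⊆ (just b∈X)))
    ... | no b∉X = nothing , just b , tt , (L⊆ b∈LY , b∉X) , (λ ()) ,
      inj₁ (first-gain (exch-⊆ (just a) (just b) (∈-add⁺ ∘ L⊆) (just (∈-add-new refl))) gain)
    exchange-hitting {a = a} {y = y} a∈Y _ _ (inj₂ (inj₁ gain)) =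
      contradiction gain (L-maximal (exch-⊆ y (just a) L⊆ (just a∈Y)))
    exchange-hitting {a = a} {Y = Y} {y = y} a∈Y (_ , a∉LY) _ (inj₂ (inj₂ (_ , tie)))
      with L-dominates (exch-⊆ y (just a) L⊆ (just a∈Y))
    ... | inj₁ worse = contradiction worse (irrefl (Eq.sym tie))
    ... | inj₂ same = contradiction (subst (a ∈_) same (∈-exch-new (L Y) y refl)) a∉LY

    exchange-avoiding : All (_∉ Y) x → All (_∉ X) y →
      InDiff (L X) (L Y) x → InDiff (L Y) (L X) y → x ≢ y →
      GainOrTie _<_ _≈_ (u₁ (L X)) (u₁ (exch (L X) x y)) (u₁ (L Y)) (u₁ (exch (L Y) y x)) →
      ExchangePair _<ℓ_ _≈ℓ_ û X Y
    exchange-avoiding {x = x} {y = y} x∉Y y∉X x∈LX∖LY y∈LY∖LX x≢y gainOrTie =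
      x , y , InDiff⁺ x (All.map L⊆ x∈LX) x∉Y , InDiff⁺ y (All.map L⊆ y∈LY) y∉X , x≢y ,
      GainOrTie-transfer
        (first-transfer (exch-mono x y L⊆) (exch-─-exch x y L⊆ x∈LX y∉X))
        (first-transfer (exch-mono y x L⊆) (exch-─-exch y x L⊆ y∈LY x∉Y))
        gainOrTie
      where
      x∈LX = InDiff⇒All x x∈LX∖LY
      y∈LY = InDiff⇒All y y∈LY∖LX

    exchange-L≢ : OrdWConcave _<_ _≈_ u₁ → L X ≢ L Y → ExchangePair _<ℓ_ _≈ℓ_ û X Y
    exchange-L≢ {X} {Y} w₁ LX≢LY with w₁ (L X) (L Y) LX≢LY
    ... | x , y , x∈LX∖LY , y∈LY∖LX , x≢y , gainOrTie with avoids-or-hits Y x | avoids-or-hits X y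
    ... | inj₂ (a , refl , a∈Y) | _ = exchange-hitting a∈Y x∈LX∖LY y∈LY∖LX gainOrTie
    ... | inj₁ _ | inj₂ (b , refl , b∈X) =
      ExchangePair-swap _<ℓ_ _≈ℓ_
        (exchange-hitting b∈X y∈LY∖LX x∈LX∖LY (GainOrTie-swap _<_ _≈_ gainOrTie))
    ... | inj₁ x∉Y | inj₁ y∉X = exchange-avoiding x∉Y y∉X x∈LX∖LY y∈LY∖LX x≢y gainOrTie

    concave : OrdWConcave _<_ _≈_ u₁ → OrdWConcave _<_ _≈_ u₂ → OrdWConcave _<ℓ_ _≈ℓ_ û
    concave w₁ w₂ X Y X≢Y with ≡-dec Bool._≟_ (L X) (L Y)
    ... | yes LX≡LY = exchange-L≡ w₂ refl (sym LX≡LY) X≢Y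
    ... | no LX≢LY = exchange-L≢ w₁ LX≢LY

theorem4p5 : (O : StrictTotalOrder 0ℓ 0ℓ 0ℓ) → (m : ℕ) →
    (u₁ u₂ : Subset (suc m) → StrictTotalOrder.Carrier O) →
    OrdWConcave (StrictTotalOrder._<_ O) (StrictTotalOrder._≈_ O) u₁ →
    UniqueMaximizer (StrictTotalOrder._<_ O) u₁ →
    OrdWConcave (StrictTotalOrder._<_ O) (StrictTotalOrder._≈_ O) u₂ →
    (û : Subset (suc m) → StrictTotalOrder.Carrier O × StrictTotalOrder.Carrier O) →
    Lex.IsLexComposition (StrictTotalOrder._<_ O) (StrictTotalOrder._≈_ O) u₁ u₂ û →
    OrdWConcave (Lex._<ℓ_ (StrictTotalOrder._<_ O) (StrictTotalOrder._≈_ O))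
      (Lex._≈ℓ_ (StrictTotalOrder._<_ O) (StrictTotalOrder._≈_ O)) û
theorem4p5 O m u₁ u₂ w₁ unique w₂ û lex = LexComposition.concave O u₁ u₂ û lex unique w₁ w₂
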